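{- Let $n\in\mathbb{N}$ be even with $n\geq 12$, and let $G=C_n(\{1,5,n-5,n-1\})$. Then $\lambda_{(3,2,1)}(G)=17$ if $n=18$, $\lambda_{(3,2,1)}(G)=15$ if $n=16$, $\lambda_{(3,2,1)}(G)=14$ if $n=32$, and $\lambda_{(3,2,1)}(G)=13$ otherwise.
   Context: For $n\ge 3$ and $S\subseteq\{1,\dots,n-1\}$ closed under $x\mapsto n-x$, the circulant $C_n(S)$ is the graph with vertex set $\{u_1,\dots,u_n\}$ in which $u_iu_j$ is an edge iff $|i-j|\in S$. An $L(3,2,1)$-labeling of a graph $G$ is a function $f:V(G)\to\mathbb{N}\cup\{0\}$ such that $|f(x)-f(y)|>3-\operatorname{dist}_G(x,y)$ for all distinct $x,y\in V(G)$. $\lambda_{(3,2,1)}(G)$ is the minimum, over all $L(3,2,1)$-labelings of $G$, of the difference between the largest and smallest label used. -}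

module Defs where

open import Data.Nat using (ℕ; zero; suc; _+_; _∸_; _≤_; _<_; ∣_-_∣)
open import Data.Fin using (Fin; toℕ)
open import Data.Product using (Σ; ∃; _×_; _,_)
open import Data.Sum using (_⊎_)
open import Relation.Binary.PropositionalEquality using (_≡_; _≢_)
open import Relation.Nullary using (¬_)

Graph : ℕ → Set₁
Graph n = Fin n → Fin n → Set

Circulant : (n : ℕ) → (ℕ → Set) → Graph n
Circulant n S i j = S ∣ toℕ i - toℕ j ∣

S15 : ℕ → ℕ → Set
S15 n d = d ≡ 1 ⊎ d ≡ 5 ⊎ d ≡ n ∸ 5 ⊎ d ≡ n ∸ 1

data Walk {n : ℕ} (G : Graph n) : Fin n → Fin n → ℕ → Set where
  here : ∀ {x} → Walk G x x 0
  step : ∀ {x y z k} → G x y → Walk G y z k → Walk G x z (suc k)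

IsDist : ∀ {n} → Graph n → Fin n → Fin n → ℕ → Set
IsDist G x y d = Walk G x y d × (∀ k → k < d → ¬ Walk G x y k)

-- L(3,2,1)-labeling: |f x - f y| > 3 - dist(x,y) for distinct x,y,
-- written as |f x - f y| + dist(x,y) > 3 (vertices at infinite distance are unconstrained).
IsL321 : ∀ {n} → Graph n → (Fin n → ℕ) → Set
IsL321 {n} G f = ∀ (x y : Fin n) → x ≢ y → ∀ d → IsDist G x y d →
  3 < ∣ f x - f y ∣ + d

IsSpan : ∀ {n} → (Fin n → ℕ) → ℕ → Set
IsSpan {n} f s = Σ (Fin n) λ lo → Σ (Fin n) λ hi →
  (∀ z → f lo ≤ f z) × (∀ z → f z ≤ f hi) × (f hi ∸ f lo ≡ s)

Lambda321 : ∀ {n} → Graph n → ℕ → Set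
Lambda321 {n} G m =
  (Σ (Fin n → ℕ) λ f → IsL321 G f × IsSpan f m) ×
  (∀ (f : Fin n → ℕ) s → IsL321 G f → IsSpan f s → m ≤ s)

module Submission where

-- Vertex u_a of C_n(1, 5, n-5, n-1) reaches u_(a+u) in k ≤ 3 steps exactly when some word of k steps
-- ±1, ±5 has displacement congruent to u modulo n.  Hence, for u ≢ 0 (mod n), an L(3,2,1)-labeling
-- separates the labels of u_a and u_(a+u) by at least req u, where 4 ∸ req u is the length of a shortest
-- word of displacement u; conversely, every n-periodic label sequence with these separations is an
-- L(3,2,1)-labeling.
-- Upper bounds are such sequences, checked by finite automata.  For span 13 they are concatenations of
-- the blocks 0 5 10 1 6 11 2 7 12 3 8 13 and 0 5 10 1 6 11 2 7 12 3 8 13 4 9, which realise every order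
-- 12 a + 14 b, hence every even n ≥ 60, together with explicit words for the remaining orders.
-- Lower bounds: with a vertex of least label moved to position 0, an exhaustive search finds no labels
-- in [0, K] for 30 consecutive vertices (for n = 16 and n = 32, for all vertices); for n = 18 any two
-- vertices are within distance 3, so all 18 labels differ.

open import Defs
open import Data.Bool.Base using (Bool; true; false; T; _∧_; if_then_else_)
open import Data.Bool.ListAction using (all; any)
open import Data.Bool.Properties using (T-∧)
open import Data.Fin.Base using (Fin; toℕ; fromℕ<)
open import Data.Fin.Properties using (toℕ-fromℕ<; toℕ-injective; toℕ<n; injective⇒≤; all?; any?) renaming (_≟_ to _≟ᶠ_)
open import Data.List.Base using (List; []; _∷_; length; map; upTo; downFrom)
open import Data.List.Membership.Propositional using (_∈_; lose)
open import Data.List.Membership.Propositional.Properties using (∈-upTo⁺; ∈-downFrom⁺)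
open import Data.List.Relation.Unary.All using (All; []; _∷_)
import Data.List.Relation.Unary.All as All
open import Data.List.Relation.Unary.All.Properties using (all⁺)
open import Data.List.Relation.Unary.Any using (here; there)
open import Data.List.Relation.Unary.Any.Properties using (any⁺)
open import Data.Nat.Base
open import Data.Nat.DivMod
open import Data.Nat.Divisibility using (_∣_; divides; _∣?_; ∣-trans; m%n≡0⇒n∣m)
open import Data.Nat.Induction using (<-rec)
open import Data.Nat.ListAction using (sum)
open import Data.Nat.Properties
open import Data.Nat.Tactic.RingSolver using (solve-∀)
open import Data.List.Membership.DecPropositional _≟_ using (_∈?_)
open import Data.Product.Base using (Σ; ∃; ∃₂; _×_; _,_; proj₁; proj₂)
open import Data.Sum.Base using (_⊎_; inj₁; inj₂)
open import Data.Unit.Base using (tt)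
open import Data.Vec.Base using (Vec; []; _∷_; lookup; _++_)
open import Function.Base using (_∘_; id)
open import Function.Bundles using (Equivalence)
open import Relation.Binary.PropositionalEquality
open import Relation.Nullary.Decidable
  using (Dec; yes; no; isYes; True; toWitness; toWitnessFalse; decidable-stable; _×-dec_; _⊎-dec_; _→-dec_; T?)
open import Relation.Nullary.Decidable.Core using (¬¬-excluded-middle)
open import Relation.Nullary.Negation using (¬_; ¬¬-map; contradiction)

-- Arithmetic modulo n

module Modular (n : ℕ) .{{_ : NonZero n}} where

  %-congˡ-+ : ∀ c {a b} → a % n ≡ b % n → (c + a) % n ≡ (c + b) % n
  %-congˡ-+ c {a} {b} a≡b = begin
    (c + a) % n         ≡⟨ %-distribˡ-+ c a n ⟩
    (c % n + a % n) % n ≡⟨ cong (λ r → (c % n + r) % n) a≡b ⟩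
    (c % n + b % n) % n ≡⟨ %-distribˡ-+ c b n ⟨
    (c + b) % n         ∎
    where open ≡-Reasoning

  %-congʳ-+ : ∀ c {a b} → a % n ≡ b % n → (a + c) % n ≡ (b + c) % n
  %-congʳ-+ c {a} {b} a≡b rewrite +-comm a c | +-comm b c = %-congˡ-+ c a≡b

  minus : ℕ → ℕ
  minus c = n ∸ c % n

  minus-inverse : ∀ c a → (minus c + (c + a)) % n ≡ a % n
  minus-inverse c a = begin
    (minus c + (c + a)) % n                 ≡⟨ cong (λ x → (minus c + (x + a)) % n) (m≡m%n+[m/n]*n c n) ⟩
    (minus c + (c % n + c / n * n + a)) % n ≡⟨ cong (_% n) (regroup (minus c) (c % n) (c / n * n) a) ⟩
    (a + (minus c + c % n + c / n * n)) % n ≡⟨ cong (λ x → (a + (x + c / n * n)) % n) (m∸n+n≡m (<⇒≤ (m%n<n c n))) ⟩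
    (a + suc (c / n) * n) % n               ≡⟨ [m+kn]%n≡m%n a (suc (c / n)) n ⟩
    a % n                                   ∎
    where
    open ≡-Reasoning
    regroup : ∀ k r q a → k + (r + q + a) ≡ a + (k + r + q)
    regroup = solve-∀

  %-cancelˡ-+ : ∀ c {a b} → (c + a) % n ≡ (c + b) % n → a % n ≡ b % n
  %-cancelˡ-+ c {a} {b} eq = begin
    a % n                   ≡⟨ minus-inverse c a ⟨
    (minus c + (c + a)) % n ≡⟨ %-congˡ-+ (minus c) eq ⟩
    (minus c + (c + b)) % n ≡⟨ minus-inverse c b ⟩
    b % n                   ∎
    where open ≡-Reasoning

  %-cancelʳ-+ : ∀ c {a b} → (a + c) % n ≡ (b + c) % n → a % n ≡ b % n
  %-cancelʳ-+ c {a} {b} rewrite +-comm a c | +-comm b c = %-cancelˡ-+ c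

  ∣m%n-[m+e]%n∣≡e∨n∸e : ∀ a {e} → e < n → ∣ a % n - (a + e) % n ∣ ≡ e ⊎ ∣ a % n - (a + e) % n ∣ ≡ n ∸ e
  ∣m%n-[m+e]%n∣≡e∨n∸e a {e} e<n with a % n + e <? n
  ... | yes x+e<n = inj₁ (begin
    ∣ x - y ∣     ≡⟨ cong (∣ x -_∣) (trans y≡ (m<n⇒m%n≡m x+e<n)) ⟩
    ∣ x - x + e ∣ ≡⟨ ∣m-m+n∣≡n x e ⟩
    e             ∎)
    where open ≡-Reasoning
          x = a % n
          y = (a + e) % n
          y≡ : y ≡ (x + e) % n
          y≡ = sym (%-congʳ-+ e (m%n%n≡m%n a n))
  ... | no  x+e≮n = inj₂ (begin
    ∣ x - y ∣           ≡⟨ cong (∣_- y ∣) y+[n∸e]≡x ⟨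
    ∣ y + (n ∸ e) - y ∣ ≡⟨ ∣-∣-comm (y + (n ∸ e)) y ⟩
    ∣ y - y + (n ∸ e) ∣ ≡⟨ ∣m-m+n∣≡n y (n ∸ e) ⟩
    n ∸ e               ∎)
    where
    open ≡-Reasoning
    x = a % n
    y = (a + e) % n
    n≤x+e = ≮⇒≥ x+e≮n
    y+n≡x+e : y + n ≡ x + e
    y+n≡x+e = begin
      y + n               ≡⟨ cong (_+ n) (%-congʳ-+ e (m%n%n≡m%n a n)) ⟨
      (x + e) % n + n     ≡⟨ cong (_+ n) (m≤n⇒[n∸m]%m≡n%m n≤x+e) ⟨
      (x + e ∸ n) % n + n ≡⟨ cong (_+ n) (m<n⇒m%n≡m (m<n+o⇒m∸n<o (x + e) n (+-mono-< (m%n<n a n) e<n))) ⟩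
      x + e ∸ n + n       ≡⟨ m∸n+n≡m n≤x+e ⟩
      x + e               ∎
    y+[n∸e]≡x : y + (n ∸ e) ≡ x
    y+[n∸e]≡x = +-cancelʳ-≡ e _ _ (begin
      y + (n ∸ e) + e ≡⟨ +-assoc y (n ∸ e) e ⟩
      y + (n ∸ e + e) ≡⟨ cong (y +_) (m∸n+n≡m (<⇒≤ e<n)) ⟩
      y + n           ≡⟨ y+n≡x+e ⟩
      x + e           ∎)

  displacement : ℕ → ℕ → ℕ
  displacement p q = (minus p + q) % n

  displacement<n : ∀ p q → displacement p q < n
  displacement<n p q = m%n<n (minus p + q) n

  +-displacement : ∀ p q → (p + displacement p q) % n ≡ q % n
  +-displacement p q = begin
    (p + (minus p + q) % n) % n ≡⟨ %-congˡ-+ p (m%n%n≡m%n (minus p + q) n) ⟩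
    (p + (minus p + q)) % n     ≡⟨ cong (_% n) (x+[y+z]≡y+[x+z] p (minus p) q) ⟩
    (minus p + (p + q)) % n     ≡⟨ minus-inverse p q ⟩
    q % n                       ∎
    where
    open ≡-Reasoning
    x+[y+z]≡y+[x+z] : ∀ x y z → x + (y + z) ≡ y + (x + z)
    x+[y+z]≡y+[x+z] = solve-∀

  vertex : ℕ → Fin n
  vertex a = fromℕ< (m%n<n a n)

  toℕ-vertex : ∀ a → toℕ (vertex a) ≡ a % n
  toℕ-vertex a = toℕ-fromℕ< (m%n<n a n)

  vertex-cong : ∀ {a b} → a % n ≡ b % n → vertex a ≡ vertex b
  vertex-cong {a} {b} eq = toℕ-injective (trans (toℕ-vertex a) (trans eq (sym (toℕ-vertex b))))

  vertex-injective : ∀ {a b} → vertex a ≡ vertex b → a % n ≡ b % n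
  vertex-injective {a} {b} eq = trans (sym (toℕ-vertex a)) (trans (cong toℕ eq) (toℕ-vertex b))

  vertex-toℕ : ∀ x → vertex (toℕ x) ≡ x
  vertex-toℕ x = toℕ-injective (trans (toℕ-vertex (toℕ x)) (m<n⇒m%n≡m (toℕ<n x)))

  vertex-% : ∀ a → vertex (a % n) ≡ vertex a
  vertex-% a = vertex-cong (m%n%n≡m%n a n)

-- Step words

C : (n : ℕ) → Graph n
C n = Circulant n (S15 n)

data Step : Set where
  +1 +5 −1 −5 : Step

Word : Set
Word = List Step

forward backward : Step → ℕ
forward +1 = 1
forward +5 = 5
forward −1 = 0
forward −5 = 0
backward +1 = 0
backward +5 = 0
backward −1 = 1
backward −5 = 5

shift : ℕ → Step → ℕ
shift n +1 = 1
shift n +5 = 5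
shift n −1 = n ∸ 1
shift n −5 = n ∸ 5

forward* backward* : Word → ℕ
forward*  = sum ∘ map forward
backward* = sum ∘ map backward

shift* : ℕ → Word → ℕ
shift* n = sum ∘ map (shift n)

shift-balance : ∀ {n} → 5 ≤ n → ∀ s → ∃ λ k → shift n s + backward s ≡ forward s + k * n
shift-balance _ +1 = 0 , refl
shift-balance _ +5 = 0 , refl
shift-balance {n} 5≤n −1 = 1 , trans (m∸n+n≡m (≤-trans (s≤s z≤n) 5≤n)) (sym (+-identityʳ n))
shift-balance {n} 5≤n −5 = 1 , trans (m∸n+n≡m 5≤n) (sym (+-identityʳ n))

shift*-balance : ∀ {n} → 5 ≤ n → ∀ ds → ∃ λ k → shift* n ds + backward* ds ≡ forward* ds + k * n
shift*-balance _ [] = 0 , refl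
shift*-balance {n} 5≤n (s ∷ ds) with shift-balance 5≤n s | shift*-balance 5≤n ds
... | k , head | l , tail = k + l , (begin
  shift n s + shift* n ds + (backward s + backward* ds) ≡⟨ interchange (shift n s) _ _ _ ⟩
  shift n s + backward s + (shift* n ds + backward* ds) ≡⟨ cong₂ _+_ head tail ⟩
  forward s + k * n + (forward* ds + l * n)             ≡⟨ collect (forward s) k _ l n ⟩
  forward s + forward* ds + (k + l) * n                 ∎)
  where
  open ≡-Reasoning
  interchange : ∀ a b c d → a + b + (c + d) ≡ a + c + (b + d)
  interchange = solve-∀
  collect : ∀ f k g l n → f + k * n + (g + l * n) ≡ f + g + (k + l) * n
  collect = solve-∀

steps : List Step
steps = +1 ∷ +5 ∷ −1 ∷ −5 ∷ []

∈-steps : ∀ s → s ∈ steps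
∈-steps +1 = here refl
∈-steps +5 = there (here refl)
∈-steps −1 = there (there (here refl))
∈-steps −5 = there (there (there (here refl)))

allWords : ℕ → (Word → Bool) → Bool
allWords zero    p = p []
allWords (suc k) p = p [] ∧ all (λ s → allWords k (p ∘ (s ∷_))) steps

allWords-sound : ∀ k p → T (allWords k p) → ∀ ds → length ds ≤ k → T (p ds)
allWords-sound zero    p check []       _         = check
allWords-sound (suc k) p check []       _         = proj₁ (Equivalence.to (T-∧ {p []}) check)
allWords-sound (suc k) p check (s ∷ ds) (s≤s len) = allWords-sound k (p ∘ (s ∷_))
  (All.lookup (all⁺ (λ s → allWords k (p ∘ (s ∷_))) steps (proj₂ (Equivalence.to (T-∧ {p []}) check))) (∈-steps s))
  ds len

-- req u = 4 ∸ (length of a shortest word of steps ±1, ±5 with displacement u), when that length is at most 3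
req : ℕ → ℕ
req 1  = 3
req 2  = 2
req 3  = 1
req 4  = 2
req 5  = 3
req 6  = 2
req 7  = 1
req 9  = 1
req 10 = 2
req 11 = 1
req 15 = 1
req _  = 0

route : ℕ → Word
route 1  = +1 ∷ []
route 2  = +1 ∷ +1 ∷ []
route 3  = +5 ∷ −1 ∷ −1 ∷ []
route 4  = +5 ∷ −1 ∷ []
route 5  = +5 ∷ []
route 6  = +5 ∷ +1 ∷ []
route 7  = +5 ∷ +1 ∷ +1 ∷ []
route 9  = +5 ∷ +5 ∷ −1 ∷ []
route 10 = +5 ∷ +5 ∷ []
route 11 = +5 ∷ +5 ∷ +1 ∷ []
route 15 = +5 ∷ +5 ∷ +5 ∷ []
route _  = []

req-≥16 : ∀ {u} → 16 ≤ u → req u ≡ 0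
req-≥16 {u} 16≤u = subst (λ v → req v ≡ 0) (m+[n∸m]≡n 16≤u) (req-16+ (u ∸ 16))
  where
  req-16+ : ∀ k → req (16 + k) ≡ 0
  req-16+ k = refl

required : ∀ {Q : ℕ → Set} (Q? : ∀ u → Dec (Q u)) →
           True (allUpTo? (λ u → (req u ≟ 0) ⊎-dec Q? u) 16) → ∀ u → req u ≡ 0 ⊎ Q u
required Q? check u with u <? 16
... | yes u<16 = toWitness check u<16
... | no  u≮16 = inj₁ (req-≥16 (≮⇒≥ u≮16))

route-correct : ∀ u → req u ≡ 0 ⊎ (forward* (route u) ≡ u + backward* (route u) × length (route u) + req u ≡ 4)
route-correct = required (λ u → (forward* (route u) ≟ u + backward* (route u)) ×-dec (length (route u) + req u ≟ 4)) _

ShortWordBound : Word → Set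
ShortWordBound ds = forward* ds ≡ backward* ds ⊎ 3 < req ∣ forward* ds - backward* ds ∣ + length ds

short-word-bound : ∀ ds → length ds ≤ 3 → ShortWordBound ds
short-word-bound ds len = toWitness {a? = shortWordBound? ds} (allWords-sound 3 (isYes ∘ shortWordBound?) tt ds len)
  where
  shortWordBound? : ∀ ds → Dec (ShortWordBound ds)
  shortWordBound? ds = (forward* ds ≟ backward* ds) ⊎-dec (3 <? req ∣ forward* ds - backward* ds ∣ + length ds)

-- Of the displacements with a nonzero requirement only 15 exceeds 11, and 15 is odd.
required-residue : ∀ {n} .{{_ : NonZero n}} → 2 ∣ n → 12 ≤ n → ∀ u → req u ≡ 0 ⊎ u % n ≢ 0
required-residue {n} 2∣n 12≤n u with required (λ u → (0 <? u ×-dec u ≤? 11) ⊎-dec u ≟ 15) _ u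
... | inj₁ req≡0                = inj₁ req≡0
... | inj₂ (inj₁ (0<u , u≤11)) = inj₂ λ u%n≡0 →
  <⇒≢ 0<u (sym (trans (sym (m<n⇒m%n≡m (<-≤-trans (s≤s u≤11) 12≤n))) u%n≡0))
... | inj₂ (inj₂ refl)          = inj₂ λ 15%n≡0 →
  toWitnessFalse {a? = 2 ∣? 15} _ (∣-trans 2∣n (m%n≡0⇒n∣m 15 n 15%n≡0))

cyclicReq : (n : ℕ) .{{_ : NonZero n}} → ℕ → ℕ → ℕ
cyclicReq n p q = req (Modular.displacement n p q) ⊔ req (Modular.displacement n q p)

Separated : (ℕ → ℕ) → Set
Separated g = ∀ a u → req u ≤ ∣ g a - g (a + u) ∣

Periodic : (n : ℕ) .{{_ : NonZero n}} → (ℕ → ℕ) → Set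
Periodic n g = ∀ a → g (a % n) ≡ g a

Labeling : ℕ → ℕ → Set
Labeling n K = Σ (Fin n → ℕ) λ f → IsL321 (C n) f × IsSpan f K

-- Walk existence is not decidable, but the bound it yields is, so a shortest walk is only needed under ¬¬.
shortest-walk : ∀ {m} {G : Graph m} {x y} k → Walk G x y k → ¬ ¬ (∃ λ d → d ≤ k × IsDist G x y d)
shortest-walk {G = G} {x} {y} = <-rec (λ k → Walk G x y k → ¬ ¬ (∃ λ d → d ≤ k × IsDist G x y d)) go
  where
  go : ∀ k → (∀ {j} → j < k → Walk G x y j → ¬ ¬ (∃ λ d → d ≤ j × IsDist G x y d)) →
       Walk G x y k → ¬ ¬ (∃ λ d → d ≤ k × IsDist G x y d)
  go k shorter w none = ¬¬-excluded-middle {A = ∃ λ j → j < k × Walk G x y j} λ where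
    (yes (j , j<k , v)) → shorter j<k v λ (d , d≤j , dist) → none (d , ≤-trans d≤j (<⇒≤ j<k) , dist)
    (no  noShorter)     → none (k , ≤-refl , w , λ j j<k v → noShorter (j , j<k , v))

walk-bound : ∀ {m} {G : Graph m} f → IsL321 G f → ∀ {x y k} → x ≢ y → Walk G x y k → 3 < ∣ f x - f y ∣ + k
walk-bound f L {x} {y} {k} x≢y w = decidable-stable (3 <? ∣ f x - f y ∣ + k) (¬¬-map bound (shortest-walk k w))
  where
  bound : ∃ (λ d → d ≤ k × IsDist _ x y d) → 3 < ∣ f x - f y ∣ + k
  bound (d , d≤k , dist) = ≤-trans (L x y x≢y d dist) (+-monoʳ-≤ ∣ f x - f y ∣ d≤k)

-- Exhaustive search

-- A row lists the separations required between the next label and the labels placed so far, latest first.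
fits : List ℕ → ℕ → List ℕ → Bool
fits (r ∷ rs) v (w ∷ ws) = (r ≤ᵇ ∣ v - w ∣′) ∧ fits rs v ws
fits _        _ _        = true

extendable : ℕ → List (List ℕ) → List ℕ → Bool
extendable K []           ws = true
extendable K (row ∷ rows) ws = any (λ v → fits row v ws ∧ extendable K rows (v ∷ ws)) (downFrom (suc K))

constraints : (ℕ → ℕ → ℕ) → ℕ → ℕ → List (List ℕ)
constraints sep i zero    = []
constraints sep i (suc m) = map (λ q → sep q i) (downFrom i) ∷ constraints sep (suc i) m

history : (ℕ → ℕ) → ℕ → List ℕ
history h i = map h (downFrom i)

module _ {K : ℕ} {sep : ℕ → ℕ → ℕ} {h : ℕ → ℕ}
         (bounded : ∀ i → h i ≤ K) (respects : ∀ {q i} → q < i → sep q i ≤ ∣ h i - h q ∣) where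

  fits-history : ∀ {i} j → j ≤ i → T (fits (map (λ q → sep q i) (downFrom j)) (h i) (history h j))
  fits-history zero        _   = tt
  fits-history {i} (suc j) j<i = Equivalence.from T-∧
    (≤⇒≤ᵇ (subst (sep j i ≤_) (∣-∣≡∣-∣′ (h i) (h j)) (respects j<i)) , fits-history j (<⇒≤ j<i))

  extendable-history : ∀ m i → T (extendable K (constraints sep i m) (history h i))
  extendable-history zero    i = tt
  extendable-history (suc m) i = any⁺ _ (lose (∈-downFrom⁺ (s≤s (bounded i)))
    (Equivalence.from T-∧ (fits-history i ≤-refl , extendable-history m (suc i))))

∣m∸o-n∸o∣≡∣m-n∣ : ∀ {m n o} → o ≤ m → o ≤ n → ∣ m ∸ o - n ∸ o ∣ ≡ ∣ m - n ∣
∣m∸o-n∸o∣≡∣m-n∣ {m} {n} {o} o≤m o≤n =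
  trans (sym (∣m+n-m+o∣≡∣n-o∣ o (m ∸ o) (n ∸ o))) (cong₂ ∣_-_∣ (m+[n∸m]≡n o≤m) (m+[n∸m]≡n o≤n))

-- Automata

module Automaton (label : ℕ → ℕ) (next : ℕ → List ℕ) where

  -- Every path of at most m further transitions from t, which lies u transitions after a state
  -- labelled v, stays separated from v.
  pathsSeparated : ℕ → ℕ → ℕ → ℕ → Bool
  pathsSeparated v u zero    t = req u ≤ᵇ ∣ v - label t ∣
  pathsSeparated v u (suc m) t = (req u ≤ᵇ ∣ v - label t ∣) ∧ all (pathsSeparated v (suc u) m) (next t)

  separatedBelow : ℕ → Bool
  separatedBelow S = all (λ t → pathsSeparated (label t) 0 15 t) (upTo S)

  module _ (σ : ℕ → ℕ) (σ-next : ∀ a → σ (suc a) ∈ next (σ a)) where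

    pathsSeparated-sound : ∀ {v u} m b → T (pathsSeparated v u m (σ b)) →
                           ∀ e → e ≤ m → req (u + e) ≤ ∣ v - label (σ (b + e)) ∣
    pathsSeparated-sound {v} {u} m b check zero _ rewrite +-identityʳ u | +-identityʳ b = ≤ᵇ⇒≤ _ _ (first m check)
      where
      first : ∀ m → T (pathsSeparated v u m (σ b)) → T (req u ≤ᵇ ∣ v - label (σ b) ∣)
      first zero    check = check
      first (suc m) check = proj₁ (Equivalence.to T-∧ check)
    pathsSeparated-sound {v} {u} (suc m) b check (suc e) (s≤s e≤m) rewrite +-suc u e | +-suc b e =
      pathsSeparated-sound m (suc b)
        (All.lookup (all⁺ (pathsSeparated v (suc u) m) (next (σ b)) (proj₂ (Equivalence.to T-∧ check))) (σ-next b))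
        e e≤m

    run-separated : ∀ S → (∀ a → σ a < S) → T (separatedBelow S) → Separated (label ∘ σ)
    run-separated S σ<S check a u with u ≤? 15
    ... | yes u≤15 = pathsSeparated-sound {label (σ a)} {0} 15 a
      (All.lookup (all⁺ (λ t → pathsSeparated (label t) 0 15 t) (upTo S) check) (∈-upTo⁺ (σ<S a))) u u≤15
    ... | no  u≰15 = subst (_≤ ∣ label (σ a) - label (σ (a + u)) ∣) (sym (req-≥16 (≰⇒> u≰15))) z≤n

CyclicOK : ∀ {n} .{{_ : NonZero n}} → ℕ → Vec ℕ n → Set
CyclicOK {n} K w = T (Automaton.separatedBelow (lookup w ∘ Modular.vertex n) (λ t → suc t % n ∷ []) n)
  × (∀ i → lookup w i ≤ K) × (∃ λ lo → lookup w lo ≡ 0) × (∃ λ hi → lookup w hi ≡ K)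

cyclicOK? : ∀ {n} .{{_ : NonZero n}} K (w : Vec ℕ n) → Dec (CyclicOK K w)
cyclicOK? K w =
  T? _ ×-dec all? (λ i → lookup w i ≤? K) ×-dec any? (λ i → lookup w i ≟ 0) ×-dec any? (λ i → lookup w i ≟ K)

module _ {n : ℕ} (5<n : 5 < n) where

  private instance
    n≢0 : NonZero n
    n≢0 = >-nonZero (<-≤-trans z<s 5<n)

  open Modular n

  5≤n : 5 ≤ n
  5≤n = <⇒≤ 5<n

  1≤n : 1 ≤ n
  1≤n = ≤-trans (s≤s z≤n) 5≤n

  shift<n : ∀ s → shift n s < n
  shift<n +1 = ≤-trans (s≤s (s≤s z≤n)) 5<n
  shift<n +5 = 5<n
  shift<n −1 = ∸-monoʳ-< z<s 1≤n
  shift<n −5 = ∸-monoʳ-< z<s 5≤n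

  shift∈S15 : ∀ s → S15 n (shift n s)
  shift∈S15 +1 = inj₁ refl
  shift∈S15 +5 = inj₂ (inj₁ refl)
  shift∈S15 −1 = inj₂ (inj₂ (inj₂ refl))
  shift∈S15 −5 = inj₂ (inj₂ (inj₁ refl))

  n∸shift∈S15 : ∀ s → S15 n (n ∸ shift n s)
  n∸shift∈S15 +1 = inj₂ (inj₂ (inj₂ refl))
  n∸shift∈S15 +5 = inj₂ (inj₂ (inj₁ refl))
  n∸shift∈S15 −1 = inj₁ (m∸[m∸n]≡n 1≤n)
  n∸shift∈S15 −5 = inj₂ (inj₁ (m∸[m∸n]≡n 5≤n))

  S15⇒shift : ∀ {d} → S15 n d → ∃ λ s → shift n s ≡ d
  S15⇒shift (inj₁ refl)               = +1 , refl
  S15⇒shift (inj₂ (inj₁ refl))        = +5 , refl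
  S15⇒shift (inj₂ (inj₂ (inj₁ refl))) = −5 , refl
  S15⇒shift (inj₂ (inj₂ (inj₂ refl))) = −1 , refl

  S15⇒n∸shift : ∀ {d} → S15 n d → ∃ λ s → d + shift n s ≡ n
  S15⇒n∸shift (inj₁ refl)               = −1 , m+[n∸m]≡n 1≤n
  S15⇒n∸shift (inj₂ (inj₁ refl))        = −5 , m+[n∸m]≡n 5≤n
  S15⇒n∸shift (inj₂ (inj₂ (inj₁ refl))) = +5 , m∸n+n≡m 5≤n
  S15⇒n∸shift (inj₂ (inj₂ (inj₂ refl))) = +1 , m∸n+n≡m 1≤n

  step-adjacent : ∀ a s → C n (vertex a) (vertex (a + shift n s))
  step-adjacent a s = subst (S15 n) (sym (cong₂ ∣_-_∣ (toℕ-vertex a) (toℕ-vertex (a + shift n s)))) adjacent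
    where
    adjacent : S15 n ∣ a % n - (a + shift n s) % n ∣
    adjacent with ∣m%n-[m+e]%n∣≡e∨n∸e a (shift<n s)
    ... | inj₁ eq = subst (S15 n) (sym eq) (shift∈S15 s)
    ... | inj₂ eq = subst (S15 n) (sym eq) (n∸shift∈S15 s)

  adjacent-step : ∀ {x y} → C n x y → ∃ λ s → toℕ y ≡ (toℕ x + shift n s) % n
  adjacent-step {x} {y} xy with ≤-total (toℕ x) (toℕ y)
  ... | inj₁ x≤y with S15⇒shift xy
  ...   | s , shift≡d = s , (begin
    toℕ y                         ≡⟨ m<n⇒m%n≡m (toℕ<n y) ⟨
    toℕ y % n                     ≡⟨ cong (_% n) (m+[n∸m]≡n x≤y) ⟨
    (toℕ x + (toℕ y ∸ toℕ x)) % n ≡⟨ cong (λ d → (toℕ x + d) % n) (trans (sym (m≤n⇒∣m-n∣≡n∸m x≤y)) (sym shift≡d)) ⟩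
    (toℕ x + shift n s) % n       ∎)
    where open ≡-Reasoning
  adjacent-step {x} {y} xy | inj₂ y≤x with S15⇒n∸shift xy
  ...   | s , d+shift≡n = s , (begin
    toℕ y                                         ≡⟨ m<n⇒m%n≡m (toℕ<n y) ⟨
    toℕ y % n                                     ≡⟨ [m+n]%n≡m%n (toℕ y) n ⟨
    (toℕ y + n) % n                               ≡⟨ cong (λ m → (toℕ y + m) % n) d+shift≡n ⟨
    (toℕ y + (∣ toℕ x - toℕ y ∣ + shift n s)) % n ≡⟨ cong (_% n) (+-assoc (toℕ y) _ _) ⟨
    (toℕ y + ∣ toℕ x - toℕ y ∣ + shift n s) % n   ≡⟨ cong (λ m → (toℕ y + m + shift n s) % n) (m≤n⇒∣n-m∣≡n∸m y≤x) ⟩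
    (toℕ y + (toℕ x ∸ toℕ y) + shift n s) % n     ≡⟨ cong (λ m → (m + shift n s) % n) (m+[n∸m]≡n y≤x) ⟩
    (toℕ x + shift n s) % n                       ∎)
    where open ≡-Reasoning

  word-walk : ∀ a ds → Walk (C n) (vertex a) (vertex (a + shift* n ds)) (length ds)
  word-walk a []       = subst (λ b → Walk (C n) (vertex a) (vertex b) 0) (sym (+-identityʳ a)) here
  word-walk a (s ∷ ds) = step (step-adjacent a s)
    (subst (λ b → Walk (C n) (vertex (a + shift n s)) (vertex b) (length ds)) (+-assoc a (shift n s) (shift* n ds))
      (word-walk (a + shift n s) ds))

  walk-word : ∀ {x y k} → Walk (C n) x y k → ∃ λ ds → length ds ≡ k × toℕ y ≡ (toℕ x + shift* n ds) % n
  walk-word {x} here = [] , refl , sym (trans (cong (_% n) (+-identityʳ (toℕ x))) (m<n⇒m%n≡m (toℕ<n x)))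
  walk-word {x} {y} (step {y = z} xz w) with adjacent-step xz | walk-word w
  ... | s , z≡ | ds , refl , y≡ = s ∷ ds , refl , (begin
    toℕ y                                 ≡⟨ y≡ ⟩
    (toℕ z + shift* n ds) % n             ≡⟨ %-congʳ-+ (shift* n ds) (trans (cong (_% n) z≡) (m%n%n≡m%n _ n)) ⟩
    (toℕ x + shift n s + shift* n ds) % n ≡⟨ cong (_% n) (+-assoc (toℕ x) _ _) ⟩
    (toℕ x + shift* n (s ∷ ds)) % n       ∎)
    where open ≡-Reasoning

  shift*-residue : ∀ ds a → (a + shift* n ds + backward* ds) % n ≡ (a + forward* ds) % n
  shift*-residue ds a with shift*-balance 5≤n ds
  ... | k , balance = begin
    (a + shift* n ds + backward* ds) % n ≡⟨ cong (_% n) (trans (+-assoc a _ _) (cong (a +_) balance)) ⟩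
    (a + (forward* ds + k * n)) % n      ≡⟨ cong (_% n) (+-assoc a _ _) ⟨
    (a + forward* ds + k * n) % n        ≡⟨ [m+kn]%n≡m%n (a + forward* ds) k n ⟩
    (a + forward* ds) % n                ∎
    where open ≡-Reasoning

  word-ahead : ∀ ds {u} → forward* ds ≡ u + backward* ds → ∀ a → (a + shift* n ds) % n ≡ (a + u) % n
  word-ahead ds {u} F≡u+B a = %-cancelʳ-+ (backward* ds) (begin
    (a + shift* n ds + backward* ds) % n ≡⟨ shift*-residue ds a ⟩
    (a + forward* ds) % n                ≡⟨ cong (λ m → (a + m) % n) F≡u+B ⟩
    (a + (u + backward* ds)) % n         ≡⟨ cong (_% n) (+-assoc a u _) ⟨
    (a + u + backward* ds) % n           ∎)
    where open ≡-Reasoning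

  word-behind : ∀ ds {u} → backward* ds ≡ u + forward* ds → ∀ a → (a + shift* n ds + u) % n ≡ a % n
  word-behind ds {u} B≡u+F a = %-cancelʳ-+ (forward* ds) (begin
    (a + shift* n ds + u + forward* ds) % n   ≡⟨ cong (_% n) (+-assoc (a + shift* n ds) u _) ⟩
    (a + shift* n ds + (u + forward* ds)) % n ≡⟨ cong (λ m → (a + shift* n ds + m) % n) B≡u+F ⟨
    (a + shift* n ds + backward* ds) % n      ≡⟨ shift*-residue ds a ⟩
    (a + forward* ds) % n                     ∎)
    where open ≡-Reasoning

  module _ (f : Fin n → ℕ) (L : IsL321 (C n) f) where

    separated : ∀ a b u → (a + u) % n ≡ b % n → u % n ≢ 0 → req u ≤ ∣ f (vertex a) - f (vertex b) ∣
    separated a b u a+u≡b u≢0 with route-correct u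
    ... | inj₁ req≡0 = subst (_≤ ∣ f (vertex a) - f (vertex b) ∣) (sym req≡0) z≤n
    ... | inj₂ (balanced , length+req≡4) =
      +-cancelʳ-≤ (length ds) (req u) _ (subst (_≤ ∣ f (vertex a) - f (vertex b) ∣ + length ds)
        (trans (sym length+req≡4) (+-comm (length ds) (req u))) (walk-bound f L distinct walk))
      where
      ds = route u
      walk : Walk (C n) (vertex a) (vertex b) (length ds)
      walk = subst (λ v → Walk (C n) (vertex a) v (length ds))
        (vertex-cong (trans (word-ahead ds balanced a) a+u≡b)) (word-walk a ds)
      distinct : vertex a ≢ vertex b
      distinct a≡b = u≢0 (begin
        u % n ≡⟨ %-cancelˡ-+ a (trans a+u≡b (trans (sym (vertex-injective a≡b)) (cong (_% n) (sym (+-identityʳ a))))) ⟩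
        0 % n ≡⟨ m<n⇒m%n≡m (<-≤-trans z<s 5<n) ⟩
        0     ∎)
        where open ≡-Reasoning

    separated-below : ∀ a b u → (a + u) % n ≡ b % n → u < n → req u ≤ ∣ f (vertex a) - f (vertex b) ∣
    separated-below a b zero    _     _   = z≤n
    separated-below a b (suc d) a+u≡b u<n =
      separated a b (suc d) a+u≡b (λ u%n≡0 → 1+n≢0 (trans (sym (m<n⇒m%n≡m u<n)) u%n≡0))

    separated-cyclic : ∀ b p q → cyclicReq n p q ≤ ∣ f (vertex (b + p)) - f (vertex (b + q)) ∣
    separated-cyclic b p q = ⊔-lub (towards p q)
      (subst (req (displacement q p) ≤_) (∣-∣-comm (f (vertex (b + q))) (f (vertex (b + p)))) (towards q p))
      where
      towards : ∀ p q → req (displacement p q) ≤ ∣ f (vertex (b + p)) - f (vertex (b + q)) ∣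
      towards p q = separated-below (b + p) (b + q) (displacement p q)
        (trans (cong (_% n) (+-assoc b p _)) (%-congˡ-+ b (+-displacement p q))) (displacement<n p q)

  -- Move a vertex of least label to position 0 and subtract that label: the search must find the result.
  search-bound : ∀ (pos : ℕ → ℕ) (sep : ℕ → ℕ → ℕ) K m → pos 0 ≡ 0 →
    (∀ f → IsL321 (C n) f → ∀ b {q i} → q < i → sep q i ≤ ∣ f (vertex (b + pos i)) - f (vertex (b + pos q)) ∣) →
    extendable K (constraints sep 1 m) (0 ∷ []) ≡ false →
    ∀ f s → IsL321 (C n) f → IsSpan f s → K < s
  search-bound pos sep K m pos0 forced refuted f s L (lo , hi , least , most , span) with K <? s
  ... | yes K<s = K<s
  ... | no  K≮s = contradiction
    (subst (T ∘ extendable K (constraints sep 1 m)) start (extendable-history bounded respects m 1))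
    (subst (λ b → ¬ T b) (sym refuted) λ ())
    where
    h : ℕ → ℕ
    h p = f (vertex (toℕ lo + pos p)) ∸ f lo
    start : history h 1 ≡ 0 ∷ []
    start = cong (_∷ []) (begin
      f (vertex (toℕ lo + pos 0)) ∸ f lo ≡⟨ cong (λ p → f (vertex (toℕ lo + p)) ∸ f lo) pos0 ⟩
      f (vertex (toℕ lo + 0)) ∸ f lo     ≡⟨ cong (λ v → f v ∸ f lo) (trans (cong vertex (+-identityʳ _)) (vertex-toℕ lo)) ⟩
      f lo ∸ f lo                        ≡⟨ n∸n≡0 (f lo) ⟩
      0                                  ∎)
      where open ≡-Reasoning
    bounded : ∀ p → h p ≤ K
    bounded p = ≤-trans (∸-monoˡ-≤ (f lo) (most _)) (subst (_≤ K) (sym span) (≮⇒≥ K≮s))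
    respects : ∀ {q i} → q < i → sep q i ≤ ∣ h i - h q ∣
    respects q<i = subst (_ ≤_) (sym (∣m∸o-n∸o∣≡∣m-n∣ (least _) (least _))) (forced f L (toℕ lo) q<i)

  cyclic-search-bound : ∀ (pos : ℕ → ℕ) K m → pos 0 ≡ 0 →
    extendable K (constraints (λ q i → cyclicReq n (pos q) (pos i)) 1 m) (0 ∷ []) ≡ false →
    ∀ f s → IsL321 (C n) f → IsSpan f s → K < s
  cyclic-search-bound pos K m pos0 = search-bound pos _ K m pos0 λ f L b {q} {i} _ →
    subst (cyclicReq n (pos q) (pos i) ≤_) (∣-∣-comm (f (vertex (b + pos q))) (f (vertex (b + pos i))))
      (separated-cyclic f L b (pos q) (pos i))

  -- If any two vertices are within distance 3, all labels differ.
  injective-bound : True (allUpTo? (λ p → allUpTo? (λ q → (p ≟ q) ⊎-dec (0 <? cyclicReq n p q)) n) n) →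
    ∀ f s → IsL321 (C n) f → IsSpan f s → n ≤ suc s
  injective-bound close f s L (lo , hi , least , most , span) = injective⇒≤ {f = φ} φ-injective
    where
    distinct : ∀ {x y} → x ≢ y → f x ≢ f y
    distinct {x} {y} x≢y fx≡fy with toWitness close (toℕ<n x) (toℕ<n y)
    ... | inj₁ x≡y   = x≢y (toℕ-injective x≡y)
    ... | inj₂ 0<req = <⇒≱ 0<req (≤-trans (separated-cyclic f L 0 (toℕ x) (toℕ y)) (≤-reflexive (begin
      ∣ f (vertex (toℕ x)) - f (vertex (toℕ y)) ∣ ≡⟨ cong₂ (λ u v → ∣ f u - f v ∣) (vertex-toℕ x) (vertex-toℕ y) ⟩
      ∣ f x - f y ∣                               ≡⟨ cong (∣_- f y ∣) fx≡fy ⟩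
      ∣ f y - f y ∣                               ≡⟨ ∣n-n∣≡0 (f y) ⟩
      0                                           ∎)))
      where open ≡-Reasoning
    φ : Fin n → Fin (suc s)
    φ x = fromℕ< (s≤s (subst (f x ∸ f lo ≤_) span (∸-monoˡ-≤ (f lo) (most x))))
    φ-injective : ∀ {x y} → φ x ≡ φ y → x ≡ y
    φ-injective {x} {y} φx≡φy with x ≟ᶠ y
    ... | yes x≡y = x≡y
    ... | no  x≢y = contradiction
      (∸-cancelʳ-≡ (least x) (least y) (trans (sym (toℕ-fromℕ< _)) (trans (cong toℕ φx≡φy) (toℕ-fromℕ< _))))
      (distinct x≢y)

  module _ (g : ℕ → ℕ) (periodic : Periodic n g) where

    periodic-cong : ∀ {a b} → a % n ≡ b % n → g a ≡ g b
    periodic-cong {a} {b} eq = trans (sym (periodic a)) (trans (cong g eq) (periodic b))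

    word-separated : Separated g → ∀ a ds → (a + shift* n ds) % n ≢ a % n → ShortWordBound ds →
                     3 < ∣ g a - g (a + shift* n ds) ∣ + length ds
    word-separated separated a ds moves (inj₁ balanced) =
      contradiction (trans (word-ahead ds balanced a) (cong (_% n) (+-identityʳ a))) moves
    word-separated separated a ds moves (inj₂ bound) with ≤-total (backward* ds) (forward* ds)
    ... | inj₁ B≤F = ≤-trans bound (+-monoˡ-≤ (length ds)
      (subst₂ (λ v m → req v ≤ ∣ g a - m ∣) (sym (m≤n⇒∣n-m∣≡n∸m B≤F))
        (periodic-cong (sym (word-ahead ds (sym (m∸n+n≡m B≤F)) a))) (separated a _)))
    ... | inj₂ F≤B = ≤-trans bound (+-monoˡ-≤ (length ds)
      (subst₂ (λ v m → req v ≤ m) (sym (m≤n⇒∣m-n∣≡n∸m F≤B))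
        (trans (cong (∣ g (a + shift* n ds) -_∣) (periodic-cong (word-behind ds (sym (m∸n+n≡m F≤B)) a)))
          (∣-∣-comm (g (a + shift* n ds)) (g a)))
        (separated (a + shift* n ds) _)))

    separated⇒L321 : Separated g → IsL321 (C n) (g ∘ toℕ)
    separated⇒L321 separated x y x≢y d (w , _) with 3 <? d
    ... | yes 3<d = ≤-trans 3<d (m≤n+m d _)
    ... | no  3≮d with walk-word w
    ...   | ds , refl , y≡ =
      subst (λ m → 3 < ∣ g (toℕ x) - m ∣ + length ds) (trans (sym (periodic _)) (cong g (sym y≡)))
        (word-separated separated (toℕ x) ds moves (short-word-bound ds (≮⇒≥ 3≮d)))
      where
      moves : (toℕ x + shift* n ds) % n ≢ toℕ x % n
      moves eq = x≢y (toℕ-injective (sym (trans y≡ (trans eq (m<n⇒m%n≡m (toℕ<n x))))))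

    periodicLabeling : ∀ {K} → Separated g → (∀ a → g a ≤ K) → ∀ lo hi → g lo ≡ 0 → g hi ≡ K → Labeling n K
    periodicLabeling {K} separated bounded lo hi g-lo g-hi =
      g ∘ toℕ , separated⇒L321 separated ,
      vertex lo , vertex hi , (λ z → subst (_≤ g (toℕ z)) (sym at-lo) z≤n) ,
      (λ z → subst (g (toℕ z) ≤_) (sym at-hi) (bounded _)) , cong₂ _∸_ at-hi at-lo
      where
      at-lo : g (toℕ (vertex lo)) ≡ 0
      at-lo = trans (cong g (toℕ-vertex lo)) (trans (periodic lo) g-lo)
      at-hi : g (toℕ (vertex hi)) ≡ K
      at-hi = trans (cong g (toℕ-vertex hi)) (trans (periodic hi) g-hi)

  cyclicLabeling : ∀ {K} (w : Vec ℕ n) → CyclicOK K w → Labeling n K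
  cyclicLabeling w (separated , bounded , (lo , w-lo) , (hi , w-hi)) =
    periodicLabeling g periodic (Automaton.run-separated label next σ σ-next n σ<n separated)
      (λ a → bounded _) (toℕ lo) (toℕ hi) (at lo w-lo) (at hi w-hi)
    where
    label : ℕ → ℕ
    label = lookup w ∘ vertex
    next : ℕ → List ℕ
    next t = suc t % n ∷ []
    σ : ℕ → ℕ
    σ a = a % n
    σ-next : ∀ a → σ (suc a) ∈ next (σ a)
    σ-next a = here (%-congˡ-+ 1 (sym (m%n%n≡m%n a n)))
    σ<n : ∀ a → σ a < n
    σ<n a = m%n<n a n
    g : ℕ → ℕ
    g = label ∘ σ
    periodic : Periodic n g
    periodic a = cong label (m%n%n≡m%n a n)
    at : ∀ {v} i → lookup w i ≡ v → g (toℕ i) ≡ v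
    at i w-i = trans (cong (lookup w) (trans (vertex-% (toℕ i)) (vertex-toℕ i))) w-i

wordLabeling : ∀ {n} K (w : Vec ℕ n) .{{_ : NonZero n}} {check : True ((5 <? n) ×-dec cyclicOK? K w)} → Labeling n K
wordLabeling K w {check} with toWitness check
... | 5<n , ok = cyclicLabeling 5<n w ok

12≤⇒5< : ∀ {n} → 12 ≤ n → 5 < n
12≤⇒5< = <-≤-trans (≤ᵇ⇒≤ 6 12 tt)

-- Blocks of span 13

blockLabel : ℕ → ℕ
blockLabel t = 5 * t % 14

-- A block of length 14 may end after 12 labels.
blockNext : ℕ → List ℕ
blockNext t = suc t % 14 ∷ (if t ≡ᵇ 11 then 0 ∷ [] else [])

block-steps : ∀ {t} → t < 12 → suc t % 12 ∈ blockNext t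
block-steps = toWitness {a? = allUpTo? (λ t → suc t % 12 ∈? blockNext t) 12} tt

module Blocks (a b : ℕ) (12≤n : 12 ≤ 12 * a + 14 * b) where

  n : ℕ
  n = 12 * a + 14 * b

  private instance
    n≢0 : NonZero n
    n≢0 = >-nonZero (<-≤-trans z<s 12≤n)

  open Modular n

  -- a blocks of length 12 followed by b blocks of length 14
  offset : ℕ → ℕ
  offset j = if j <ᵇ 12 * a then j % 12 else (j ∸ 12 * a) % 14

  offset-X : ∀ {j} → j < 12 * a → offset j ≡ j % 12
  offset-X {j} j<c with j <ᵇ 12 * a | <⇒<ᵇ j<c
  ... | true  | _  = refl
  ... | false | ()

  offset-Y : ∀ {j} → 12 * a ≤ j → offset j ≡ (j ∸ 12 * a) % 14
  offset-Y {j} c≤j with j <ᵇ 12 * a | <ᵇ⇒< j (12 * a)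
  ... | false | _   = refl
  ... | true  | j<c = contradiction (j<c tt) (≤⇒≯ c≤j)

  offset≤c : ∀ {j} → j ≤ 12 * a → offset j ≡ j % 12
  offset≤c {j} j≤c with m≤n⇒m<n∨m≡n j≤c
  ... | inj₁ j<c  = offset-X j<c
  ... | inj₂ refl = begin
    offset (12 * a)        ≡⟨ offset-Y ≤-refl ⟩
    (12 * a ∸ 12 * a) % 14 ≡⟨ cong (_% 14) (n∸n≡0 (12 * a)) ⟩
    0                      ≡⟨ m*n%n≡0 a 12 ⟨
    a * 12 % 12            ≡⟨ cong (_% 12) (*-comm a 12) ⟩
    12 * a % 12            ∎
    where open ≡-Reasoning

  offset-step : ∀ j → offset (suc j) ∈ blockNext (offset j)
  offset-step j with j <? 12 * a
  ... | yes j<c = subst₂ _∈_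
    (sym (trans (offset≤c j<c) (Modular.%-congˡ-+ 12 1 {j} {j % 12} (sym (m%n%n≡m%n j 12)))))
    (cong blockNext (sym (offset≤c (<⇒≤ j<c)))) (block-steps (m%n<n j 12))
  ... | no  j≮c = subst₂ _∈_
    (sym (trans (offset-Y (m≤n⇒m≤1+n c≤j)) (trans (cong (_% 14) (+-∸-assoc 1 c≤j))
      (Modular.%-congˡ-+ 14 1 {j ∸ 12 * a} {(j ∸ 12 * a) % 14} (sym (m%n%n≡m%n (j ∸ 12 * a) 14))))))
    (cong blockNext (sym (offset-Y c≤j))) (here refl)
    where c≤j = ≮⇒≥ j≮c

  offset-0 : offset 0 ≡ 0
  offset-0 = offset≤c z≤n

  offset-n : offset n ≡ 0
  offset-n = begin
    offset n          ≡⟨ offset-Y (m≤m+n (12 * a) (14 * b)) ⟩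
    (n ∸ 12 * a) % 14 ≡⟨ cong (_% 14) (m+n∸m≡n (12 * a) (14 * b)) ⟩
    14 * b % 14       ≡⟨ cong (_% 14) (*-comm 14 b) ⟩
    b * 14 % 14       ≡⟨ m*n%n≡0 b 14 ⟩
    0                 ∎
    where open ≡-Reasoning

  offset-% : ∀ {k} → k ≤ n → offset (k % n) ≡ offset k
  offset-% k≤n with m≤n⇒m<n∨m≡n k≤n
  ... | inj₁ k<n  = cong offset (m<n⇒m%n≡m k<n)
  ... | inj₂ refl = trans (cong offset (n%n≡0 n)) (trans offset-0 (sym offset-n))

  offset<14 : ∀ j → offset j < 14
  offset<14 j with j <ᵇ 12 * a
  ... | true  = ≤-trans (m%n<n j 12) (≤ᵇ⇒≤ 12 14 tt)
  ... | false = m%n<n (j ∸ 12 * a) 14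

  offset-11 : offset 11 ≡ 11
  offset-11 with 11 <? 12 * a
  ... | yes 11<c = offset-X 11<c
  ... | no  11≮c = trans (offset-Y (≮⇒≥ 11≮c)) (cong (λ m → (11 ∸ 12 * m) % 14) a≡0)
    where
    a≡0 : a ≡ 0
    a≡0 = n<1⇒n≡0 (*-cancelˡ-< 12 a 1 (≤-<-trans (≮⇒≥ 11≮c) (n<1+n 11)))

  σ : ℕ → ℕ
  σ j = offset (j % n)

  σ-next : ∀ j → σ (suc j) ∈ blockNext (σ j)
  σ-next j = subst (_∈ blockNext (σ j))
    (sym (trans (cong offset (%-congˡ-+ 1 (sym (m%n%n≡m%n j n)))) (offset-% (m%n<n j n))))
    (offset-step (j % n))

  blockLabeling : Labeling n 13
  blockLabeling = periodicLabeling (12≤⇒5< 12≤n) g periodic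
    (Automaton.run-separated blockLabel blockNext σ σ-next 14 (offset<14 ∘ (_% n)) tt)
    (λ j → ≤-pred (m%n<n (5 * σ j) 14)) 0 11
    (cong blockLabel (trans (offset-% z≤n) offset-0))
    (cong blockLabel (trans (cong offset (m<n⇒m%n≡m 12≤n)) offset-11))
    where
    g : ℕ → ℕ
    g = blockLabel ∘ σ
    periodic : Periodic n g
    periodic j = cong (blockLabel ∘ offset) (m%n%n≡m%n j n)

BlockOrder : ℕ → Set
BlockOrder n = ∃₂ λ a b → n ≡ 12 * a + 14 * b

-- n = 2 (6 q + r) with r ≤ 5 ≤ q gives n = 12 (q ∸ r) + 14 r.
blockOrder-≥60 : ∀ {n} → 2 ∣ n → 60 ≤ n → BlockOrder n
blockOrder-≥60 (divides m refl) 60≤n = q ∸ r , r , (begin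
  m * 2                     ≡⟨ cong (_* 2) (m≡m%n+[m/n]*n m 6) ⟩
  (r + q * 6) * 2           ≡⟨ cong (λ x → (r + x * 6) * 2) (m∸n+n≡m r≤q) ⟨
  (r + (q ∸ r + r) * 6) * 2 ≡⟨ regroup (q ∸ r) r ⟩
  12 * (q ∸ r) + 14 * r     ∎)
  where
  open ≡-Reasoning
  r = m % 6
  q = m / 6
  r≤q : r ≤ q
  r≤q = ≤-trans (≤-pred (m%n<n m 6)) (/-monoˡ-≤ 6 (*-cancelʳ-≤ 30 m 2 60≤n))
  regroup : ∀ d r → (r + (d + r) * 6) * 2 ≡ 12 * d + 14 * r
  regroup = solve-∀

-- The even orders from 12 on that are not of the form 12 a + 14 b, apart from 16, 18 and 32.
sporadicOrders : List ℕ
sporadicOrders = 20 ∷ 22 ∷ 30 ∷ 34 ∷ 44 ∷ 46 ∷ 58 ∷ []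

SmallOrder : ℕ → Set
SmallOrder n = 2 ∣ n → 12 ≤ n →
  (∃ λ a → a < 5 × ∃ λ b → b < 5 × n ≡ 12 * a + 14 * b) ⊎ n ∈ 16 ∷ 18 ∷ 32 ∷ sporadicOrders

smallOrder? : ∀ n → Dec (SmallOrder n)
smallOrder? n = (2 ∣? n) →-dec (12 ≤? n) →-dec
  (anyUpTo? (λ a → anyUpTo? (λ b → n ≟ 12 * a + 14 * b) 5) 5 ⊎-dec (n ∈? 16 ∷ 18 ∷ 32 ∷ sporadicOrders))

even-orders : ∀ {n} → 2 ∣ n → 12 ≤ n → BlockOrder n ⊎ n ∈ 16 ∷ 18 ∷ 32 ∷ sporadicOrders
even-orders {n} 2∣n 12≤n with n <? 60
... | no  n≮60 = inj₁ (blockOrder-≥60 2∣n (≮⇒≥ n≮60))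
... | yes n<60 with toWitness {a? = allUpTo? smallOrder? 60} tt n<60 2∣n 12≤n
...   | inj₁ (a , _ , b , _ , n≡) = inj₁ (a , b , n≡)
...   | inj₂ exceptional          = inj₂ exceptional

block : Vec ℕ 12
block = 0 ∷ 5 ∷ 10 ∷ 1 ∷ 6 ∷ 11 ∷ 2 ∷ 7 ∷ 12 ∷ 3 ∷ 8 ∷ 13 ∷ []

word22 : Vec ℕ 22
word22 = 0 ∷ 3 ∷ 6 ∷ 11 ∷ 2 ∷ 7 ∷ 10 ∷ 13 ∷ 0 ∷ 5 ∷ 12 ∷ 1 ∷ 4 ∷ 7 ∷ 10 ∷ 3 ∷ 6 ∷ 9 ∷ 12 ∷ 1 ∷ 8 ∷ 13 ∷ []

word34 : Vec ℕ 34
word34 = 0 ∷ 5 ∷ 10 ∷ 1 ∷ 6 ∷ 3 ∷ 8 ∷ 13 ∷ 4 ∷ 9 ∷ 12 ∷ 1 ∷ 6 ∷ 11 ∷ 0 ∷ 5 ∷ 10 ∷ 3 ∷ 8 ∷ 13 ∷ 2 ∷ 7 ∷ 12 ∷ 1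
       ∷ 4 ∷ 9 ∷ 0 ∷ 5 ∷ 10 ∷ 7 ∷ 12 ∷ 3 ∷ 8 ∷ 13 ∷ []

sporadicLabelings : All (λ n → Labeling n 13) sporadicOrders
sporadicLabelings =
    wordLabeling 13 (0 ∷ 3 ∷ 8 ∷ 1 ∷ 4 ∷ 9 ∷ 12 ∷ 5 ∷ 10 ∷ 13 ∷ 2 ∷ 7 ∷ 0 ∷ 3 ∷ 8 ∷ 5 ∷ 10 ∷ 13 ∷ 6 ∷ 11 ∷ [])
  ∷ wordLabeling 13 word22
  ∷ wordLabeling 13 (0 ∷ 3 ∷ 6 ∷ 13 ∷ 2 ∷ 5 ∷ 8 ∷ 11 ∷ 0 ∷ 7 ∷ 10 ∷ 13 ∷ 2 ∷ 5 ∷ 12 ∷ 3 ∷ 0 ∷ 7 ∷ 10 ∷ 1 ∷ 8 ∷ 5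
                       ∷ 12 ∷ 3 ∷ 6 ∷ 13 ∷ 10 ∷ 1 ∷ 8 ∷ 11 ∷ [])
  ∷ wordLabeling 13 word34
  ∷ wordLabeling 13 (word22 ++ word22)
  ∷ wordLabeling 13 (block ++ word34)
  ∷ wordLabeling 13 (block ++ block ++ word34)
  ∷ []

labeling13 : ∀ {n} → 2 ∣ n → 12 ≤ n → n ≢ 16 → n ≢ 18 → n ≢ 32 → Labeling n 13
labeling13 2∣n 12≤n n≢16 n≢18 n≢32 with even-orders 2∣n 12≤n
... | inj₁ (a , b , refl)                   = Blocks.blockLabeling a b 12≤n
... | inj₂ (here refl)                      = contradiction refl n≢16
... | inj₂ (there (here refl))              = contradiction refl n≢18
... | inj₂ (there (there (here refl)))      = contradiction refl n≢32
... | inj₂ (there (there (there sporadic))) = All.lookup sporadicLabelings sporadic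

labeling16 : Labeling 16 15
labeling16 = wordLabeling 15 (0 ∷ 3 ∷ 6 ∷ 1 ∷ 8 ∷ 11 ∷ 14 ∷ 9 ∷ 4 ∷ 13 ∷ 2 ∷ 7 ∷ 12 ∷ 15 ∷ 10 ∷ 5 ∷ [])

labeling18 : Labeling 18 17
labeling18 = wordLabeling 17 (0 ∷ 3 ∷ 6 ∷ 1 ∷ 4 ∷ 7 ∷ 10 ∷ 13 ∷ 8 ∷ 11 ∷ 14 ∷ 17 ∷ 2 ∷ 5 ∷ 16 ∷ 9 ∷ 12 ∷ 15 ∷ [])

labeling32 : Labeling 32 14
labeling32 = wordLabeling 14 (0 ∷ 3 ∷ 6 ∷ 1 ∷ 12 ∷ 5 ∷ 10 ∷ 13 ∷ 4 ∷ 7 ∷ 14 ∷ 1 ∷ 8 ∷ 11 ∷ 2 ∷ 9 ∷ 12 ∷ 3 ∷ 6 ∷ 13 ∷ 0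
                              ∷ 5 ∷ 10 ∷ 1 ∷ 4 ∷ 7 ∷ 2 ∷ 13 ∷ 8 ∷ 11 ∷ 14 ∷ 9 ∷ [])

-- Lower bounds

lower-bound-13 : ∀ {n} → 2 ∣ n → 12 ≤ n → ∀ f s → IsL321 (C n) f → IsSpan f s → 12 < s
lower-bound-13 {n} 2∣n 12≤n = search-bound (12≤⇒5< 12≤n) id (λ q i → req (i ∸ q)) 12 29 refl forced refl
  where
  instance
    n≢0 : NonZero n
    n≢0 = >-nonZero (<-≤-trans z<s 12≤n)
  open Modular n
  forced : ∀ f → IsL321 (C n) f → ∀ b {q i} → q < i → req (i ∸ q) ≤ ∣ f (vertex (b + i)) - f (vertex (b + q)) ∣
  forced f L b {q} {i} q<i with required-residue 2∣n 12≤n (i ∸ q)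
  ... | inj₁ req≡0   = subst (_≤ ∣ f (vertex (b + i)) - f (vertex (b + q)) ∣) (sym req≡0) z≤n
  ... | inj₂ u%n≢0 = subst (req (i ∸ q) ≤_) (∣-∣-comm (f (vertex (b + q))) (f (vertex (b + i))))
    (separated (12≤⇒5< 12≤n) f L (b + q) (b + i) (i ∸ q)
      (cong (_% n) (trans (+-assoc b q _) (cong (b +_) (m+[n∸m]≡n (<⇒≤ q<i))))) u%n≢0)

-- Visiting the vertices in the order 0, 5, 10, … keeps the search small.
lower-bound-16 : ∀ f s → IsL321 (C 16) f → IsSpan f s → 14 < s
lower-bound-16 = cyclic-search-bound (≤ᵇ⇒≤ 6 16 tt) (5 *_) 14 15 refl refl

lower-bound-18 : ∀ f s → IsL321 (C 18) f → IsSpan f s → 16 < s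
lower-bound-18 f s L span = ≤-pred (injective-bound (≤ᵇ⇒≤ 6 18 tt) tt f s L span)

lower-bound-32 : ∀ f s → IsL321 (C 32) f → IsSpan f s → 13 < s
lower-bound-32 = cyclic-search-bound (≤ᵇ⇒≤ 6 32 tt) id 13 31 refl refl

mainTheorem12 : ∀ (n : ℕ) → 2 ∣ n → 12 ≤ n →
    (n ≡ 18 → Lambda321 (Circulant n (S15 n)) 17) ×
    (n ≡ 16 → Lambda321 (Circulant n (S15 n)) 15) ×
    (n ≡ 32 → Lambda321 (Circulant n (S15 n)) 14) ×
    (n ≢ 18 → n ≢ 16 → n ≢ 32 → Lambda321 (Circulant n (S15 n)) 13)
mainTheorem12 n 2∣n 12≤n =
    (λ { refl → labeling18 , lower-bound-18 })
  , (λ { refl → labeling16 , lower-bound-16 })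
  , (λ { refl → labeling32 , lower-bound-32 })
  , λ n≢18 n≢16 n≢32 → labeling13 2∣n 12≤n n≢16 n≢18 n≢32 , lower-bound-13 2∣n 12≤n
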